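{- For each positive integer $k$, there is a graph $G_k$ with $r_v(G_k)-r'_v(G_k)=k$.
   Context: Graphs are finite, connected, may have multiple edges but no loops. A graph $H$ is class 1 if $\chi'(H)=\Delta(H)$, where $\chi'$ is the chromatic index. For a graph $G$, $r_v(G)$ is the minimum number of vertices that have to be removed from $G$ to obtain a class 1 graph, and $r'_v(G)$ is the minimum number of vertices that have to be removed from $G$ to obtain a graph $K$ with $\chi'(K)\le \Delta(G)$. -}

module Defs where

open import Data.Nat using (ℕ; zero; suc; _≤_; _⊔_; _+_)
open import Data.Fin using (Fin; _≟_)
open import Data.Fin.Subset using (Subset; ∣_∣; inside; outside)
open import Data.Product using (Σ; ∃; _×_; _,_; proj₁; proj₂)
open import Data.Sum using (_⊎_)
open import Data.Bool using (Bool; true; false; not; _∧_; _∨_; if_then_else_; T)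
open import Data.List using (List; map; foldr; allFin)
open import Data.Nat.ListAction using (sum)
open import Data.Vec using (lookup)
open import Relation.Nullary using (¬_)
open import Relation.Nullary.Decidable using (⌊_⌋)
open import Relation.Binary.PropositionalEquality using (_≡_; _≢_)
open import Relation.Binary.Construct.Closure.ReflexiveTransitive using (Star)

record Graph : Set where
  field
    n        : ℕ
    E        : ℕ
    ends     : Fin E → Fin n × Fin n
    loopless : ∀ e → proj₁ (ends e) ≢ proj₂ (ends e)

module _ (G : Graph) where
  open Graph G

  Adj : Fin n → Fin n → Set
  Adj u w = ∃ λ e → (ends e ≡ (u , w)) ⊎ (ends e ≡ (w , u))

  Connected : Set
  Connected = ∀ u v → Star Adj u v

  -- G - S, for a set S of removed vertices (inside = removed).
  -- An edge survives iff neither of its ends is removed.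
  removed? : Subset n → Fin n → Bool
  removed? S v with lookup S v
  ... | inside  = true
  ... | outside = false

  survives? : Subset n → Fin E → Bool
  survives? S e = not (removed? S (proj₁ (ends e))) ∧ not (removed? S (proj₂ (ends e)))

  Survives : Subset n → Fin E → Set
  Survives S e = T (survives? S e)

  incident? : Fin E → Fin n → Bool
  incident? e v = ⌊ proj₁ (ends e) ≟ v ⌋ ∨ ⌊ proj₂ (ends e) ≟ v ⌋

  Incident : Fin E → Fin n → Set
  Incident e v = T (incident? e v)

  deg : Subset n → Fin n → ℕ
  deg S v = sum (map (λ e → if survives? S e ∧ incident? e v then 1 else 0) (allFin E))

  Δ : Subset n → ℕ
  Δ S = foldr _⊔_ 0 (map (deg S) (allFin n))

  Colourable : Subset n → ℕ → Set
  Colourable S c =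
    Σ ((e : Fin E) → Survives S e → Fin c) λ f →
      ∀ e e' (s : Survives S e) (s' : Survives S e') → e ≢ e' →
        (∃ λ v → Incident e v × Incident e' v) → f e s ≢ f e' s'

  IsChromaticIndex : Subset n → ℕ → Set
  IsChromaticIndex S k = Colourable S k × (∀ j → Colourable S j → k ≤ j)

  ChromaticIndexAtMost : Subset n → ℕ → Set
  ChromaticIndexAtMost S c = ∃ λ k → IsChromaticIndex S k × k ≤ c

  Class1 : Subset n → Set
  Class1 S = IsChromaticIndex S (Δ S)

  ΔG : ℕ
  ΔG = Δ (Data.Vec.replicate n outside)

  IsRv : ℕ → Set
  IsRv r = (∃ λ S → ∣ S ∣ ≡ r × Class1 S) × (∀ S → Class1 S → r ≤ ∣ S ∣)

  IsRv' : ℕ → Set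
  IsRv' r = (∃ λ S → ∣ S ∣ ≡ r × ChromaticIndexAtMost S ΔG)
          × (∀ S → ChromaticIndexAtMost S ΔG → r ≤ ∣ S ∣)

-- Gₖ consists of the hub, a triangle whose sides have multiplicity M = k + 2, and k outer
-- triangles whose sides have multiplicity m = k + 1, each hung by a pendant edge from the same
-- hub corner, the apex. The 3M hub edges pairwise meet, so the hub needs 3M > 2M + k = Δ(Gₖ)
-- colours: every removal set leaving a colouring with at most Δ(Gₖ) colours hits the hub. Once
-- it does, every degree is at most 2m + 1 < 3m, while an intact outer triangle still needs 3m
-- colours; so reaching class 1 also forces a removed vertex in every outer triangle, and
-- r_v = k + 1, attained by the corners 0. Removing just the apex leaves chromatic index
-- 3m ≤ Δ(Gₖ), so r'_v = 1.

module Submission where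

open import Defs

open import Data.Bool using (Bool; true; false; T; not; _∧_; if_then_else_)
open import Data.Bool.Properties using (T-irrelevant; T-∧; T-∨)
open import Data.Empty using (⊥; ⊥-elim)
open import Data.Fin using (Fin; zero; suc; punchIn; punchOut; inject₁; inject≤; combine; fromℕ<; _≟_)
open import Data.Fin.Patterns using (0F; 1F; 2F)
open import Data.Fin.Properties using (1↔⊤; +↔⊎; *↔×; any?; injective⇒≤; punchInᵢ≢i; punchIn-injective;
  punchIn-punchOut; punchOut-injective; inject₁-injective; inject≤-injective; combine-injective)
open import Data.Fin.Subset using (Subset; ∣_∣; inside; outside)
open import Data.List using (allFin; foldr)
import Data.List as List
open import Data.List.Properties using (map-tabulate)
open import Data.Nat using (ℕ; zero; suc; _+_; _*_; _≤_; _<_; _⊔_; z≤n)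
open import Data.Nat.ListAction using (sum)
open import Data.Nat.Properties using (module ≤-Reasoning; ≤-trans; ≤-antisym; <⇒≱; m≤m+n; +-monoʳ-≤; +-comm;
  ⊔-lub; m≤m⊔n; m≤n⊔m)
open import Data.Nat.Tactic.RingSolver using (solve-∀)
open import Data.Product using (Σ; ∃; _×_; _,_; proj₁; proj₂)
import Data.Product as Product
open import Data.Product.Function.NonDependent.Propositional using (_×-↔_)
open import Data.Product.Properties using (Σ-≡,≡→≡; ,-injective; ,-injectiveʳ; ×-≡,≡→≡; ≡-dec)
open import Data.Sum using (_⊎_; inj₁; inj₂; [_,_])
import Data.Sum as Sum
open import Data.Sum.Function.Propositional using (_⊎-↔_)
open import Data.Sum.Properties using (inj₁-injective)
open import Data.Unit using (⊤; tt)
open import Data.Vec using ([]; _∷_; lookup; replicate; tabulate)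
open import Data.Vec.Properties using (lookup∘tabulate; lookup-replicate)
open import Function using (_∘_; id; _↔_; _⇔_; mk⇔; mk↔ₛ′; Inverse; Equivalence)
open import Function.Properties.Inverse using (↔-refl; ↔-sym; ↔-trans)
open import Relation.Binary.Construct.Closure.ReflexiveTransitive using (Star; ε; _◅_; _◅◅_; gmap; reverse)
open import Relation.Binary.PropositionalEquality
  using (_≡_; _≢_; refl; sym; trans; cong; subst; ≢-sym; module ≡-Reasoning)
open import Relation.Nullary using (¬_; Dec; yes; no)
open import Relation.Nullary.Decidable using (T?; ⌊_⌋; toWitness; fromWitness; decidable-stable)

count : ∀ {n} → (Fin n → Bool) → ℕ
count {zero}  p = 0
count {suc n} p = (if p zero then 1 else 0) + count (p ∘ suc)

sum-indicator≡count : ∀ {n} (p : Fin n → Bool) →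
  sum (List.map (λ i → if p i then 1 else 0) (allFin n)) ≡ count p
sum-indicator≡count {zero}  p = refl
sum-indicator≡count {suc n} p = cong ((if p zero then 1 else 0) +_) (begin
  sum (List.map indicator (List.tabulate suc))  ≡⟨ cong sum (map-tabulate suc indicator) ⟩
  sum (List.tabulate (indicator ∘ suc))         ≡⟨ cong sum (sym (map-tabulate id (indicator ∘ suc))) ⟩
  sum (List.map (indicator ∘ suc) (allFin n))   ≡⟨ sum-indicator≡count (p ∘ suc) ⟩
  count (p ∘ suc)                               ∎)
  where
  open ≡-Reasoning
  indicator : Fin (suc n) → ℕ
  indicator i = if p i then 1 else 0

Satisfying : ∀ {n} → (Fin n → Bool) → Set
Satisfying {n} p = Σ (Fin n) (T ∘ p)

Σ-Fin-suc↔ : ∀ {n} (P : Fin (suc n) → Set) → Σ (Fin (suc n)) P ↔ (P zero ⊎ Σ (Fin n) (P ∘ suc))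
Σ-Fin-suc↔ P = mk↔ₛ′ split unsplit [ (λ _ → refl) , (λ _ → refl) ] unsplit∘split
  where
  split : Σ _ P → P zero ⊎ Σ _ (P ∘ suc)
  split (zero  , x) = inj₁ x
  split (suc i , x) = inj₂ (i , x)
  unsplit : P zero ⊎ Σ _ (P ∘ suc) → Σ _ P
  unsplit (inj₁ x)       = zero , x
  unsplit (inj₂ (i , x)) = suc i , x
  unsplit∘split : ∀ x → unsplit (split x) ≡ x
  unsplit∘split (zero  , _) = refl
  unsplit∘split (suc _ , _) = refl

T⊎↔Fin : ∀ b {c} {X : Set} → X ↔ Fin c → (T b ⊎ X) ↔ Fin ((if b then 1 else 0) + c)
T⊎↔Fin true  X↔ = ↔-trans (↔-sym 1↔⊤ ⊎-↔ X↔) (↔-sym +↔⊎)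
T⊎↔Fin false X↔ = ↔-trans (mk↔ₛ′ [ (λ ()) , id ] inj₂ (λ _ → refl) [ (λ ()) , (λ _ → refl) ]) X↔

Satisfying↔Fin-count : ∀ {n} (p : Fin n → Bool) → Satisfying p ↔ Fin (count p)
Satisfying↔Fin-count {zero}  p = mk↔ₛ′ (λ ()) (λ ()) (λ ()) (λ ())
Satisfying↔Fin-count {suc n} p =
  ↔-trans (Σ-Fin-suc↔ (T ∘ p)) (T⊎↔Fin (p zero) (Satisfying↔Fin-count (p ∘ suc)))

module _ {n} (p : Fin n → Bool) where
  private
    open module C = Inverse (Satisfying↔Fin-count p) using (to; from)

    satisfying-≡ : {x y : Satisfying p} → proj₁ x ≡ proj₁ y → x ≡ y
    satisfying-≡ refl = Σ-≡,≡→≡ (refl , T-irrelevant _ _)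

  count≤ : ∀ {d} (f : ∀ i → T (p i) → Fin d) →
           (∀ {i j} pi pj → f i pi ≡ f j pj → i ≡ j) → count p ≤ d
  count≤ f f-inj = injective⇒≤ {f = f′} λ {a} {b} eq → begin
    a             ≡⟨ sym (C.strictlyInverseˡ a) ⟩
    to (from a)   ≡⟨ cong to (satisfying-≡ (f-inj _ _ eq)) ⟩
    to (from b)   ≡⟨ C.strictlyInverseˡ b ⟩
    b             ∎
    where
    open ≡-Reasoning
    f′ : Fin (count p) → _
    f′ a = let (i , pi) = from a in f i pi

  ≤count : ∀ {d} (g : Fin d → Fin n) → (∀ {a b} → g a ≡ g b → a ≡ b) →
           (∀ a → T (p (g a))) → d ≤ count p
  ≤count g g-inj pg = injective⇒≤ {f = λ a → to (g a , pg a)} λ {a} {b} eq →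
    g-inj (cong proj₁ (begin
      (g a , pg a)            ≡⟨ sym (C.strictlyInverseʳ _) ⟩
      from (to (g a , pg a))  ≡⟨ cong from eq ⟩
      from (to (g b , pg b))  ≡⟨ C.strictlyInverseʳ _ ⟩
      (g b , pg b)            ∎))
    where open ≡-Reasoning

foldr-⊔-tabulate≤ : ∀ {n d} (f : Fin n → ℕ) → (∀ i → f i ≤ d) → foldr _⊔_ 0 (List.tabulate f) ≤ d
foldr-⊔-tabulate≤ {zero}  f f≤d = z≤n
foldr-⊔-tabulate≤ {suc n} f f≤d = ⊔-lub (f≤d zero) (foldr-⊔-tabulate≤ (f ∘ suc) (f≤d ∘ suc))

≤foldr-⊔-tabulate : ∀ {n} (f : Fin n → ℕ) i → f i ≤ foldr _⊔_ 0 (List.tabulate f)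
≤foldr-⊔-tabulate f zero    = m≤m⊔n _ _
≤foldr-⊔-tabulate f (suc i) = ≤-trans (≤foldr-⊔-tabulate (f ∘ suc) i) (m≤n⊔m _ _)

T-not⇒¬T : ∀ {b} → T (not b) → ¬ T b
T-not⇒¬T {false} _ ()

¬T⇒T-not : ∀ {b} → ¬ T b → T (not b)
¬T⇒T-not {false} _  = _
¬T⇒T-not {true}  ¬t = ¬t _

∣∣≡count-lookup : ∀ {n} (S : Subset n) → ∣ S ∣ ≡ count (lookup S)
∣∣≡count-lookup []            = refl
∣∣≡count-lookup (inside  ∷ S) = cong suc (∣∣≡count-lookup S)
∣∣≡count-lookup (outside ∷ S) = ∣∣≡count-lookup S

module _ (G : Graph) where
  open Graph G

  removed?≡lookup : ∀ S v → removed? G S v ≡ lookup S v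
  removed?≡lookup S v with lookup S v
  ... | inside  = refl
  ... | outside = refl

  EndOf : Fin E → Fin n → Set
  EndOf e v = proj₁ (ends e) ≡ v ⊎ proj₂ (ends e) ≡ v

  incident⇒EndOf : ∀ {e v} → Incident G e v → EndOf e v
  incident⇒EndOf {e} {v} inc with Equivalence.to (T-∨ {⌊ proj₁ (ends e) ≟ v ⌋}) inc
  ... | inj₁ t = inj₁ (toWitness t)
  ... | inj₂ t = inj₂ (toWitness t)

  EndOf⇒incident : ∀ {e v} → EndOf e v → Incident G e v
  EndOf⇒incident {e} {v} end = Equivalence.from (T-∨ {⌊ proj₁ (ends e) ≟ v ⌋})
    (Sum.map fromWitness fromWitness end)

  survives⇒kept : ∀ {S e v} → Survives G S e → EndOf e v → ¬ T (removed? G S v)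
  survives⇒kept {S} {e} s (inj₁ refl) = T-not⇒¬T (proj₁ (Equivalence.to (T-∧ {not (removed? G S _)}) s))
  survives⇒kept {S} {e} s (inj₂ refl) = T-not⇒¬T (proj₂ (Equivalence.to (T-∧ {not (removed? G S _)}) s))

  kept⇒survives : ∀ {S e} → (∀ {v} → EndOf e v → ¬ T (removed? G S v)) → Survives G S e
  kept⇒survives {S} {e} kept = Equivalence.from (T-∧ {not (removed? G S (proj₁ (ends e)))})
    (¬T⇒T-not (kept (inj₁ refl)) , ¬T⇒T-not (kept (inj₂ refl)))

  Δ≤ : ∀ {S d} → (∀ v → deg G S v ≤ d) → Δ G S ≤ d
  Δ≤ {S} deg≤d rewrite map-tabulate id (deg G S) = foldr-⊔-tabulate≤ (deg G S) deg≤d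

  deg≤Δ : ∀ S v → deg G S v ≤ Δ G S
  deg≤Δ S v rewrite map-tabulate id (deg G S) = ≤foldr-⊔-tabulate (deg G S) v

  Colourable-mono : ∀ {S c c′} → c ≤ c′ → Colourable G S c → Colourable G S c′
  Colourable-mono {S} c≤c′ (f , proper) =
    (λ e s → inject≤ (f e s) c≤c′) ,
    λ e e′ s s′ e≢e′ shared eq → proper e e′ s s′ e≢e′ shared (inject≤-injective c≤c′ c≤c′ _ _ eq)

  Δ≤colours : ∀ {S c} → Colourable G S c → Δ G S ≤ c
  Δ≤colours {S} {c} (f , proper) = Δ≤ {S} λ v →
    subst (_≤ c) (sym (sum-indicator≡count (live-at v))) (count≤ (live-at v) (colour v) (colour-injective v))
    where
    live-at : Fin n → Fin E → Bool
    live-at v e = survives? G S e ∧ incident? G e v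
    colour : ∀ v e → T (live-at v e) → Fin c
    colour v e p = f e (proj₁ (Equivalence.to T-∧ p))
    colour-injective : ∀ v {e e′} p p′ → colour v e p ≡ colour v e′ p′ → e ≡ e′
    colour-injective v {e} {e′} p p′ eq = decidable-stable (e ≟ e′) λ e≢e′ →
      proper e e′ _ _ e≢e′ (v , proj₂ (Equivalence.to T-∧ p) , proj₂ (Equivalence.to T-∧ p′)) eq

  Colourable⇒Class1 : ∀ {S} → Colourable G S (Δ G S) → Class1 G S
  Colourable⇒Class1 {S} col = col , λ _ → Δ≤colours {S}

  AtMost⇒Colourable : ∀ {S c} → ChromaticIndexAtMost G S c → Colourable G S c
  AtMost⇒Colourable {S} (_ , (col , _) , χ′≤c) = Colourable-mono {S} χ′≤c col

↔-injective : ∀ {A B : Set} (A↔B : A ↔ B) {x y} → Inverse.to A↔B x ≡ Inverse.to A↔B y → x ≡ y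
↔-injective A↔B {x} {y} eq = trans (sym (strictlyInverseʳ x)) (trans (cong from eq) (strictlyInverseʳ y))
  where open Inverse A↔B

⊎↔Fin : ∀ {A B : Set} {a b} → A ↔ Fin a → B ↔ Fin b → (A ⊎ B) ↔ Fin (a + b)
⊎↔Fin A↔ B↔ = ↔-trans (A↔ ⊎-↔ B↔) (↔-sym +↔⊎)

×↔Fin : ∀ {A B : Set} {a b} → A ↔ Fin a → B ↔ Fin b → (A × B) ↔ Fin (a * b)
×↔Fin A↔ B↔ = ↔-trans (A↔ ×-↔ B↔) (↔-sym *↔×)

-- Graph is indexed by Fin; these lemmas handle degrees, colourings, cliques and removal sets
-- through structured vertex and edge types V and Ed instead.
module Presented {V Ed : Set} {nV nE : ℕ} (V↔ : V ↔ Fin nV) (E↔ : Ed ↔ Fin nE)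
  (ends : Ed → V × V) (ends-distinct : ∀ x → proj₁ (ends x) ≢ proj₂ (ends x))
  (_∈ₑ_ : V → Ed → Set)
  (∈ₑ⇔ends : ∀ {y x} → y ∈ₑ x ⇔ (proj₁ (ends x) ≡ y ⊎ proj₂ (ends x) ≡ y))
  where

  private
    module V = Inverse V↔
    module E = Inverse E↔

  graph : Graph
  graph = record
    { n        = nV
    ; E        = nE
    ; ends     = λ e → V.to (proj₁ (ends (E.from e))) , V.to (proj₂ (ends (E.from e)))
    ; loopless = λ e → ends-distinct (E.from e) ∘ ↔-injective V↔
    }

  index : V → Fin nV
  index = V.to

  Removed : Subset nV → V → Set
  Removed S y = T (removed? graph S (index y))

  Removed? : ∀ S y → Dec (Removed S y)
  Removed? S y = T? (removed? graph S (index y))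

  Live : Subset nV → Ed → Set
  Live S x = ∀ y → y ∈ₑ x → ¬ Removed S y

  Δ≤-index : ∀ {S d} → (∀ y → deg graph S (index y) ≤ d) → Δ graph S ≤ d
  Δ≤-index {S} {d} deg≤d = Δ≤ graph {S} λ v →
    subst (λ v → deg graph S v ≤ d) (V.strictlyInverseˡ v) (deg≤d (V.from v))

  incident⇒∈ₑ : ∀ {e v} → Incident graph e v → V.from v ∈ₑ E.from e
  incident⇒∈ₑ inc = Equivalence.from ∈ₑ⇔ends (Sum.map from-end from-end (incident⇒EndOf graph inc))
    where
    from-end : ∀ {u v} → V.to u ≡ v → u ≡ V.from v
    from-end {u} eq = trans (sym (V.strictlyInverseʳ u)) (cong V.from eq)

  ∈ₑ⇒incident : ∀ {y x} → y ∈ₑ x → Incident graph (E.to x) (V.to y)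
  ∈ₑ⇒incident {y} {x} y∈x = EndOf⇒incident graph (Sum.map (cong V.to) (cong V.to)
    (Equivalence.to ∈ₑ⇔ends (subst (y ∈ₑ_) (sym (E.strictlyInverseʳ x)) y∈x)))

  survives⇒live : ∀ {S e} → Survives graph S e → Live S (E.from e)
  survives⇒live {S} s y y∈e =
    survives⇒kept graph {S} s (Sum.map (cong V.to) (cong V.to) (Equivalence.to ∈ₑ⇔ends y∈e))

  live⇒survives : ∀ {S x} → Live S x → Survives graph S (E.to x)
  live⇒survives {S} {x} live = kept⇒survives graph {S} λ where
      (inj₁ refl) → live′ _ (Equivalence.from ∈ₑ⇔ends (inj₁ refl))
      (inj₂ refl) → live′ _ (Equivalence.from ∈ₑ⇔ends (inj₂ refl))
    where
    live′ : Live S (E.from (E.to x))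
    live′ = subst (Live S) (sym (E.strictlyInverseʳ x)) live

  deg≤ : ∀ {S y d} {Y : Set} → Y ↔ Fin d →
         (code : ∀ x → Live S x → y ∈ₑ x → Y) →
         (∀ {x x′} l i l′ i′ → code x l i ≡ code x′ l′ i′ → x ≡ x′) →
         deg graph S (index y) ≤ d
  deg≤ {S} {y} {d} Y↔ code code-injective =
    subst (_≤ d) (sym (sum-indicator≡count live-at-y)) (count≤ live-at-y f f-injective)
    where
    live-at-y : Fin nE → Bool
    live-at-y e = survives? graph S e ∧ incident? graph e (index y)
    live-and-on : ∀ {e} → T (live-at-y e) → Live S (E.from e) × y ∈ₑ E.from e
    live-and-on {e} p with Equivalence.to (T-∧ {survives? graph S e}) p
    ... | s , i = survives⇒live {S} s , subst (_∈ₑ E.from e) (V.strictlyInverseʳ y) (incident⇒∈ₑ i)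
    f : ∀ e → T (live-at-y e) → Fin d
    f e p = Inverse.to Y↔ (code (E.from e) (proj₁ (live-and-on p)) (proj₂ (live-and-on p)))
    f-injective : ∀ {e e′} p p′ → f e p ≡ f e′ p′ → e ≡ e′
    f-injective p p′ eq = ↔-injective (↔-sym E↔) (code-injective _ _ _ _ (↔-injective Y↔ eq))

  ≤deg : ∀ {S y d} {Y : Set} → Y ↔ Fin d →
         (edge : Y → Ed) → (∀ {z z′} → edge z ≡ edge z′ → z ≡ z′) →
         (∀ z → Live S (edge z)) → (∀ z → y ∈ₑ edge z) →
         d ≤ deg graph S (index y)
  ≤deg {S} {y} {d} Y↔ edge edge-injective live on =
    subst (d ≤_) (sym (sum-indicator≡count live-at-y)) (≤count live-at-y g g-injective g-live)
    where
    live-at-y : Fin nE → Bool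
    live-at-y e = survives? graph S e ∧ incident? graph e (index y)
    g : Fin d → Fin nE
    g a = E.to (edge (Inverse.from Y↔ a))
    g-injective : ∀ {a b} → g a ≡ g b → a ≡ b
    g-injective eq = ↔-injective (↔-sym Y↔) (edge-injective (↔-injective E↔ eq))
    g-live : ∀ a → T (live-at-y (g a))
    g-live a = Equivalence.from (T-∧ {survives? graph S (g a)}) (live⇒survives {S} (live _) , ∈ₑ⇒incident (on _))

  Proper : Subset nV → ∀ {c} → (Ed → Fin c) → Set
  Proper S col =
    ∀ {x x′ y} → Live S x → Live S x′ → y ∈ₑ x → y ∈ₑ x′ → col x ≡ col x′ → x ≡ x′

  colourable : ∀ {S c} (col : Ed → Fin c) → Proper S col → Colourable graph S c
  colourable {S} col proper = (λ e _ → col (E.from e)) , λ e e′ s s′ e≢e′ (v , i , i′) eq →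
    e≢e′ (↔-injective (↔-sym E↔)
      (proper (survives⇒live {S} s) (survives⇒live {S} s′) (incident⇒∈ₑ i) (incident⇒∈ₑ i′) eq))

  clique≤colours : ∀ {S c t} {Y : Set} → Y ↔ Fin t →
    (edge : Y → Ed) → (∀ {z z′} → edge z ≡ edge z′ → z ≡ z′) → (∀ z → Live S (edge z)) →
    (∀ z z′ → ∃ λ y → y ∈ₑ edge z × y ∈ₑ edge z′) → Colourable graph S c → t ≤ c
  clique≤colours {S} {t = t} Y↔ edge edge-injective live meet (f , proper) =
    injective⇒≤ {f = colour} colour-injective
    where
    e : Fin t → Fin nE
    e a = E.to (edge (Inverse.from Y↔ a))
    colour : Fin t → _
    colour a = f (e a) (live⇒survives {S} (live _))
    colour-injective : ∀ {a b} → colour a ≡ colour b → a ≡ b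
    colour-injective {a} {b} eq = decidable-stable (a ≟ b) λ a≢b →
      let (y , i , i′) = meet (Inverse.from Y↔ a) (Inverse.from Y↔ b) in
      proper (e a) (e b) _ _
        (a≢b ∘ ↔-injective (↔-sym Y↔) ∘ edge-injective ∘ ↔-injective E↔)
        (V.to y , ∈ₑ⇒incident i , ∈ₑ⇒incident i′) eq

  removal : (V → Bool) → Subset nV
  removal P = tabulate (P ∘ V.from)

  removed?-removal : ∀ P y → removed? graph (removal P) (V.to y) ≡ P y
  removed?-removal P y = begin
    removed? graph (removal P) (V.to y)  ≡⟨ removed?≡lookup graph (removal P) (V.to y) ⟩
    lookup (removal P) (V.to y)          ≡⟨ lookup∘tabulate (P ∘ V.from) (V.to y) ⟩
    P (V.from (V.to y))                  ≡⟨ cong P (V.strictlyInverseʳ y) ⟩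
    P y                                  ∎
    where open ≡-Reasoning

  nothing-removed : ∀ y → ¬ Removed (replicate nV outside) y
  nothing-removed y = subst T
    (trans (removed?≡lookup graph (replicate nV outside) (V.to y)) (lookup-replicate (V.to y) outside))

  ≤∣∣ : ∀ {S d} {Y : Set} → Y ↔ Fin d →
        (vertex : Y → V) → (∀ {z z′} → vertex z ≡ vertex z′ → z ≡ z′) →
        (∀ z → Removed S (vertex z)) → d ≤ ∣ S ∣
  ≤∣∣ {S} {d} Y↔ vertex vertex-injective removed =
    subst (d ≤_) (sym (∣∣≡count-lookup S)) (≤count (lookup S) g g-injective g-removed)
    where
    g : Fin d → Fin nV
    g a = V.to (vertex (Inverse.from Y↔ a))
    g-injective : ∀ {a b} → g a ≡ g b → a ≡ b
    g-injective eq = ↔-injective (↔-sym Y↔) (vertex-injective (↔-injective V↔ eq))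
    g-removed : ∀ a → T (lookup S (g a))
    g-removed a = subst T (removed?≡lookup graph S (g a)) (removed _)

  ∣∣≤ : ∀ {S d} {Y : Set} → Y ↔ Fin d →
        (code : ∀ y → Removed S y → Y) → (∀ {y y′} r r′ → code y r ≡ code y′ r′ → y ≡ y′) →
        ∣ S ∣ ≤ d
  ∣∣≤ {S} {d} Y↔ code code-injective =
    subst (_≤ d) (sym (∣∣≡count-lookup S)) (count≤ (lookup S) f f-injective)
    where
    removed : ∀ {v} → T (lookup S v) → Removed S (V.from v)
    removed {v} r = subst T (sym (removed?≡lookup graph S _))
      (subst (T ∘ lookup S) (sym (V.strictlyInverseˡ v)) r)
    f : ∀ v → T (lookup S v) → Fin d
    f v r = Inverse.to Y↔ (code (V.from v) (removed r))
    f-injective : ∀ {v v′} r r′ → f v r ≡ f v′ r′ → v ≡ v′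
    f-injective r r′ eq = ↔-injective (↔-sym V↔) (code-injective _ _ (↔-injective Y↔ eq))

  Joined : V → V → Set
  Joined u w = ∃ λ x → ends x ≡ (u , w)

  connected : (r : V) → (∀ y → Star Joined r y) → Connected graph
  connected r path u v = reverse adj-sym (path′ u) ◅◅ path′ v
    where
    adj : ∀ {u w} → Joined u w → Adj graph (V.to u) (V.to w)
    adj (x , eq) = E.to x , inj₁ (trans
      (cong (λ x′ → V.to (proj₁ (ends x′)) , V.to (proj₂ (ends x′))) (E.strictlyInverseʳ x))
      (cong (Product.map V.to V.to) eq))
    adj-sym : ∀ {u w} → Adj graph u w → Adj graph w u
    adj-sym (e , end) = e , Sum.swap end
    path′ : ∀ v → Star (Adj graph) (V.to r) v
    path′ v = subst (Star (Adj graph) (V.to r)) (V.strictlyInverseˡ v) (gmap V.to adj (path (V.from v)))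

-- In a triangle on the corners Fin 3, side σ is the side opposite corner σ: its ends are
-- punchIn σ 0 and punchIn σ 1, so a corner s lies on side σ exactly when s ≢ σ.
side-ends : ∀ {σ s : Fin 3} → s ≢ σ → punchIn σ 0F ≡ s ⊎ punchIn σ 1F ≡ s
side-ends s≢σ with punchOut (≢-sym s≢σ) | punchIn-punchOut (≢-sym s≢σ)
... | 0F | eq = inj₁ eq
... | 1F | eq = inj₂ eq

side-ends-distinct : ∀ (σ : Fin 3) → punchIn σ 0F ≢ punchIn σ 1F
side-ends-distinct σ eq with punchIn-injective σ 0F 1F eq
... | ()

common-corner : ∀ (σ τ : Fin 3) → ∃ λ s → s ≢ σ × s ≢ τ
common-corner σ τ with punchIn σ 0F ≟ τ
... | no  c₀≢τ = punchIn σ 0F , punchInᵢ≢i σ 0F , c₀≢τ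
... | yes c₀≡τ = punchIn σ 1F , punchInᵢ≢i σ 1F , λ c₁≡τ → side-ends-distinct σ (trans c₀≡τ (sym c₁≡τ))

-- The graphs Gₖ

≤-offset : ∀ {a b} d → a + d ≡ b → a ≤ b
≤-offset d refl = m≤m+n _ d

module Gₖ (k : ℕ) where

  m M : ℕ
  m = suc k
  M = suc m

  Vertex : Set
  Vertex = Fin (suc k) × Fin 3

  pattern hubV s   = (zero , s)
  pattern triV i s = (suc i , s)

  Edge : Set
  Edge = (Fin 3 × Fin M) ⊎ ((Fin k × Fin 3 × Fin m) ⊎ Fin k)

  pattern hub σ p     = inj₁ (σ , p)
  pattern tri i σ q   = inj₂ (inj₁ (i , σ , q))
  pattern pendant i   = inj₂ (inj₂ i)

  Vertex↔ : Vertex ↔ Fin (suc k * 3)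
  Vertex↔ = ×↔Fin ↔-refl ↔-refl

  Edge↔ : Edge ↔ Fin (3 * M + (k * (3 * m) + k))
  Edge↔ = ⊎↔Fin (×↔Fin ↔-refl ↔-refl) (⊎↔Fin (×↔Fin ↔-refl (×↔Fin ↔-refl ↔-refl)) ↔-refl)

  ends : Edge → Vertex × Vertex
  ends (hub σ _)   = hubV (punchIn σ 0F) , hubV (punchIn σ 1F)
  ends (tri i σ _) = triV i (punchIn σ 0F) , triV i (punchIn σ 1F)
  ends (pendant i) = hubV 0F , triV i 0F

  ends-distinct : ∀ x → proj₁ (ends x) ≢ proj₂ (ends x)
  ends-distinct (hub σ _)   = side-ends-distinct σ ∘ ,-injectiveʳ
  ends-distinct (tri i σ _) = side-ends-distinct σ ∘ ,-injectiveʳ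
  ends-distinct (pendant i) ()

  infix 4 _∈ₑ_
  _∈ₑ_ : Vertex → Edge → Set
  hubV s   ∈ₑ hub σ _   = s ≢ σ
  triV i s ∈ₑ tri j σ _ = i ≡ j × s ≢ σ
  hubV s   ∈ₑ pendant _ = s ≡ 0F
  triV i s ∈ₑ pendant j = i ≡ j × s ≡ 0F
  hubV _   ∈ₑ tri _ _ _ = ⊥
  triV _ _ ∈ₑ hub _ _   = ⊥

  ∈ₑ⇔ends : ∀ {y x} → y ∈ₑ x ⇔ (proj₁ (ends x) ≡ y ⊎ proj₂ (ends x) ≡ y)
  ∈ₑ⇔ends {y} {x} = mk⇔ (∈ₑ⇒end y x) (end⇒∈ₑ y x)
    where
    ∈ₑ⇒end : ∀ y x → y ∈ₑ x → proj₁ (ends x) ≡ y ⊎ proj₂ (ends x) ≡ y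
    ∈ₑ⇒end (hubV s)   (hub σ _)    s≢σ        = Sum.map (cong (zero ,_)) (cong (zero ,_)) (side-ends s≢σ)
    ∈ₑ⇒end (triV i s) (tri .i σ _) (refl , s≢σ) = Sum.map (cong (suc i ,_)) (cong (suc i ,_)) (side-ends s≢σ)
    ∈ₑ⇒end (hubV s)   (pendant _)  refl        = inj₁ refl
    ∈ₑ⇒end (triV i s) (pendant .i) (refl , refl) = inj₂ refl
    end⇒∈ₑ : ∀ y x → proj₁ (ends x) ≡ y ⊎ proj₂ (ends x) ≡ y → y ∈ₑ x
    end⇒∈ₑ _ (hub σ _)   (inj₁ refl) = punchInᵢ≢i σ 0F
    end⇒∈ₑ _ (hub σ _)   (inj₂ refl) = punchInᵢ≢i σ 1F
    end⇒∈ₑ _ (tri i σ _) (inj₁ refl) = refl , punchInᵢ≢i σ 0F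
    end⇒∈ₑ _ (tri i σ _) (inj₂ refl) = refl , punchInᵢ≢i σ 1F
    end⇒∈ₑ _ (pendant i) (inj₁ refl) = refl
    end⇒∈ₑ _ (pendant i) (inj₂ refl) = refl , refl

  open Presented Vertex↔ Edge↔ ends ends-distinct _∈ₑ_ ∈ₑ⇔ends public

  2m+1≤2M+k : 2 * m + 1 ≤ 2 * M + k
  2m+1≤2M+k = ≤-offset (suc k) (identity k)
    where identity : ∀ k → 2 * suc k + 1 + suc k ≡ 2 * suc (suc k) + k
          identity = solve-∀

  2M+k<3M : 2 * M + k < 3 * M
  2M+k<3M = ≤-offset 1 (identity k)
    where identity : ∀ k → suc (2 * suc (suc k) + k) + 1 ≡ 3 * suc (suc k)
          identity = solve-∀

  M+k≤2m+1 : M + k ≤ 2 * m + 1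
  M+k≤2m+1 = ≤-offset 1 (identity k)
    where identity : ∀ k → suc (suc k) + k + 1 ≡ 2 * suc k + 1
          identity = solve-∀

  M≤3m : M ≤ 3 * m
  M≤3m = ≤-offset (2 * k + 1) (identity k)
    where identity : ∀ k → suc (suc k) + (2 * k + 1) ≡ 3 * suc k
          identity = solve-∀

  3m≤2M+k : 3 * m ≤ 2 * M + k
  3m≤2M+k = ≤-offset 1 (identity k)
    where identity : ∀ k → 3 * suc k + 1 ≡ 2 * suc (suc k) + k
          identity = solve-∀

  2m+1<3m : 1 ≤ k → 2 * m + 1 < 3 * m
  2m+1<3m 1≤k = begin
    suc (2 * m + 1)  ≡⟨ +-comm 1 (2 * m + 1) ⟩
    2 * m + 1 + 1    ≤⟨ +-monoʳ-≤ (2 * m + 1) 1≤k ⟩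
    2 * m + 1 + k    ≡⟨ identity k ⟩
    3 * m            ∎
    where open ≤-Reasoning
          identity : ∀ k → 2 * suc k + 1 + k ≡ 3 * suc k
          identity = solve-∀

  live-hub⇒opposite : ∀ {S h σ p} → Removed S (hubV h) → Live S (hub σ p) → σ ≡ h
  live-hub⇒opposite {h = h} {σ} removed live =
    sym (decidable-stable (h ≟ σ) λ h≢σ → live (hubV h) h≢σ removed)

  live-tri⇒opposite : ∀ {S i h σ q} → Removed S (triV i h) → Live S (tri i σ q) → σ ≡ h
  live-tri⇒opposite {i = i} {h} {σ} removed live =
    sym (decidable-stable (h ≟ σ) λ h≢σ → live (triV i h) (refl , h≢σ) removed)

  pendant-dead : ∀ {S i} → Removed S (hubV 0F) → ¬ Live S (pendant i)
  pendant-dead removed live = live (hubV 0F) refl removed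

  hub-tri-apart : ∀ {y σ p i τ q} → y ∈ₑ hub σ p → ¬ y ∈ₑ tri i τ q
  hub-tri-apart {hubV _} _ ()

  tri-meet⇒same : ∀ {y i σ q j τ q′} → y ∈ₑ tri i σ q → y ∈ₑ tri j τ q′ → i ≡ j
  tri-meet⇒same {triV _ _} (refl , _) (refl , _) = refl

  hub-code : ∀ s x → hubV s ∈ₑ x → (Fin 2 × Fin M) ⊎ Fin k
  hub-code s (hub σ p)   s≢σ = inj₁ (punchOut s≢σ , p)
  hub-code s (pendant i) _   = inj₂ i

  hub-code-injective : ∀ {s x x′} o o′ → hub-code s x o ≡ hub-code s x′ o′ → x ≡ x′
  hub-code-injective {x = hub σ p} {hub σ′ p′} s≢σ s≢σ′ eq with ,-injective (inj₁-injective eq)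
  ... | eq₁ , refl = cong (λ τ → hub τ p) (punchOut-injective s≢σ s≢σ′ eq₁)
  hub-code-injective {x = pendant _} {pendant _} _ _ refl = refl
  hub-code-injective {x = hub _ _}   {pendant _} _ _ ()
  hub-code-injective {x = pendant _} {hub _ _}   _ _ ()

  tri-code : ∀ i s x → triV i s ∈ₑ x → (Fin 2 × Fin m) ⊎ ⊤
  tri-code i s (tri .i σ q) (refl , s≢σ) = inj₁ (punchOut s≢σ , q)
  tri-code i s (pendant .i) (refl , _)   = inj₂ tt

  tri-code-injective : ∀ {i s x x′} o o′ → tri-code i s x o ≡ tri-code i s x′ o′ → x ≡ x′
  tri-code-injective {x = tri _ σ q} {tri _ σ′ q′} (refl , s≢σ) (refl , s≢σ′) eq
    with ,-injective (inj₁-injective eq)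
  ... | eq₁ , refl = cong (λ τ → tri _ τ q) (punchOut-injective s≢σ s≢σ′ eq₁)
  tri-code-injective {x = pendant _} {pendant _} (refl , _) (refl , _) _ = refl
  tri-code-injective {x = tri _ _ _} {pendant _} (refl , _) (refl , _) ()
  tri-code-injective {x = pendant _} {tri _ _ _} (refl , _) (refl , _) ()

  deg-tri≤2m+1 : ∀ S i s → deg graph S (index (triV i s)) ≤ 2 * m + 1
  deg-tri≤2m+1 S i s = deg≤ {S} (⊎↔Fin (×↔Fin ↔-refl ↔-refl) (↔-sym 1↔⊤))
    (λ x _ → tri-code i s x) (λ _ o _ o′ → tri-code-injective o o′)

  deg≤2M+k : ∀ S y → deg graph S (index y) ≤ 2 * M + k
  deg≤2M+k S (hubV s)   = deg≤ {S} (⊎↔Fin (×↔Fin ↔-refl ↔-refl) ↔-refl)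
    (λ x _ → hub-code s x) (λ _ o _ o′ → hub-code-injective o o′)
  deg≤2M+k S (triV i s) = ≤-trans (deg-tri≤2m+1 S i s) 2m+1≤2M+k

  Δ≤2M+k : ∀ S → Δ graph S ≤ 2 * M + k
  Δ≤2M+k S = Δ≤-index {S} (deg≤2M+k S)

  -- With hub corner h removed, only hub side h (opposite h) survives, so a hub corner keeps
  -- at most M + k edges.
  Δ≤2m+1 : ∀ {S h} → Removed S (hubV h) → Δ graph S ≤ 2 * m + 1
  Δ≤2m+1 {S} {h} removed = Δ≤-index {S} λ where
      (hubV s)   → ≤-trans (deg≤ {S} (⊎↔Fin ↔-refl ↔-refl) (λ x _ → opposite-code s x) code-injective)
                           M+k≤2m+1
      (triV i s) → deg-tri≤2m+1 S i s
    where
    opposite-code : ∀ s x → hubV s ∈ₑ x → Fin M ⊎ Fin k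
    opposite-code s (hub _ p)   _ = inj₁ p
    opposite-code s (pendant i) _ = inj₂ i
    code-injective : ∀ {s x x′} l o l′ o′ → opposite-code s x o ≡ opposite-code s x′ o′ → x ≡ x′
    code-injective {x = hub σ p} {hub σ′ p} l _ l′ _ refl
      with live-hub⇒opposite {S} {h} {σ} removed l | live-hub⇒opposite {S} {h} {σ′} removed l′
    ... | refl | refl = refl
    code-injective {x = pendant _} {pendant _} _ _ _ _ refl = refl
    code-injective {x = hub _ _}   {pendant _} _ _ _ _ ()
    code-injective {x = pendant _} {hub _ _}   _ _ _ _ ()

  3m≤ΔG : 3 * m ≤ ΔG graph
  3m≤ΔG = ≤-trans 3m≤2M+k (≤-trans 2M+k≤deg-apex (deg≤Δ graph (replicate _ outside) (index (hubV 0F))))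
    where
    apex-edge : (Fin 2 × Fin M) ⊎ Fin k → Edge
    apex-edge (inj₁ (b , p)) = hub (suc b) p
    apex-edge (inj₂ i)       = pendant i
    apex-edge-injective : ∀ {z z′} → apex-edge z ≡ apex-edge z′ → z ≡ z′
    apex-edge-injective {inj₁ _} {inj₁ _} refl = refl
    apex-edge-injective {inj₂ _} {inj₂ _} refl = refl
    on-apex : ∀ z → hubV 0F ∈ₑ apex-edge z
    on-apex (inj₁ _) ()
    on-apex (inj₂ _) = refl
    2M+k≤deg-apex : 2 * M + k ≤ deg graph (replicate _ outside) (index (hubV 0F))
    2M+k≤deg-apex = ≤deg {replicate _ outside} (⊎↔Fin (×↔Fin ↔-refl ↔-refl) ↔-refl)
      apex-edge apex-edge-injective (λ _ y _ → nothing-removed y) on-apex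

  hub-clique : ∀ {S c} → (∀ h → ¬ Removed S (hubV h)) → Colourable graph S c → 3 * M ≤ c
  hub-clique {S} kept = clique≤colours {S} (×↔Fin ↔-refl ↔-refl) inj₁ inj₁-injective live meet
    where
    live : ∀ z → Live S (inj₁ z)
    live _ (hubV s) _ = kept s
    meet : ∀ z z′ → ∃ λ y → y ∈ₑ inj₁ z × y ∈ₑ inj₁ z′
    meet (σ , _) (τ , _) = let s , s≢σ , s≢τ = common-corner σ τ in hubV s , s≢σ , s≢τ

  triangle-clique : ∀ {S c} i → (∀ s → ¬ Removed S (triV i s)) → Colourable graph S c → 3 * m ≤ c
  triangle-clique {S} i kept = clique≤colours {S} (×↔Fin ↔-refl ↔-refl) side side-injective live meet
    where
    side : Fin 3 × Fin m → Edge
    side (σ , q) = tri i σ q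
    side-injective : ∀ {z z′} → side z ≡ side z′ → z ≡ z′
    side-injective refl = refl
    live : ∀ z → Live S (side z)
    live _ (triV _ s) (refl , _) = kept s
    meet : ∀ z z′ → ∃ λ y → y ∈ₑ side z × y ∈ₑ side z′
    meet (σ , _) (τ , _) = let s , s≢σ , s≢τ = common-corner σ τ in triV i s , (refl , s≢σ) , (refl , s≢τ)

  hub-hit : ∀ {S c} → c ≤ 2 * M + k → Colourable graph S c → ∃ λ h → Removed S (hubV h)
  hub-hit {S} c≤2M+k col = decidable-stable (any? (λ h → Removed? S (hubV h))) λ ¬hit →
    <⇒≱ 2M+k<3M (≤-trans (hub-clique {S} (λ h r → ¬hit (h , r)) col) c≤2M+k)

  triangle-hit : ∀ {S h} → 1 ≤ k → Removed S (hubV h) → Colourable graph S (Δ graph S) →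
                 ∀ i → ∃ λ s → Removed S (triV i s)
  triangle-hit {S} 1≤k hub-removed col i = decidable-stable (any? (λ s → Removed? S (triV i s))) λ ¬hit →
    <⇒≱ (2m+1<3m 1≤k) (≤-trans (triangle-clique {S} i (λ s r → ¬hit (s , r)) col) (Δ≤2m+1 {S} hub-removed))

  ≤∣∣-transversal : ∀ {S} (w : Fin (suc k) → Fin 3) → (∀ b → Removed S (b , w b)) → suc k ≤ ∣ S ∣
  ≤∣∣-transversal {S} w = ≤∣∣ {S} ↔-refl (λ b → b , w b) (cong proj₁)

  corner₀? : Vertex → Bool
  corner₀? (_ , s) = ⌊ s ≟ 0F ⌋

  corners₀ : Subset (suc k * 3)
  corners₀ = removal corner₀?

  corner₀-of-removed : ∀ {y} → Removed corners₀ y → proj₂ y ≡ 0F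
  corner₀-of-removed {y} r = toWitness (subst T (removed?-removal corner₀? y) r)

  corner₀-removed : ∀ b → Removed corners₀ (b , 0F)
  corner₀-removed b = subst T (sym (removed?-removal corner₀? (b , 0F))) tt

  ∣corners₀∣ : ∣ corners₀ ∣ ≡ suc k
  ∣corners₀∣ = ≤-antisym
    (∣∣≤ {corners₀} ↔-refl (λ y _ → proj₁ y)
      λ {y} {y′} r r′ eq →
        ×-≡,≡→≡ (eq , trans (corner₀-of-removed {y} r) (sym (corner₀-of-removed {y′} r′))))
    (≤∣∣-transversal {corners₀} (λ _ → 0F) corner₀-removed)

  copy-colour : Edge → Fin M
  copy-colour (hub _ p)   = p
  copy-colour (tri _ _ q) = inject₁ q
  copy-colour (pendant _) = 0F

  copy-colour-proper : Proper corners₀ copy-colour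
  copy-colour-proper {pendant _} l _ _ _ _ = ⊥-elim (pendant-dead {corners₀} (corner₀-removed 0F) l)
  copy-colour-proper {_} {pendant _} _ l′ _ _ _ = ⊥-elim (pendant-dead {corners₀} (corner₀-removed 0F) l′)
  copy-colour-proper {hub _ _}   {tri _ _ _} _ _ o o′ _ = ⊥-elim (hub-tri-apart o o′)
  copy-colour-proper {tri _ _ _} {hub _ _}   _ _ o o′ _ = ⊥-elim (hub-tri-apart o′ o)
  copy-colour-proper {hub σ p} {hub σ′ _} l l′ _ _ refl
    with live-hub⇒opposite {corners₀} {0F} {σ} (corner₀-removed 0F) l
       | live-hub⇒opposite {corners₀} {0F} {σ′} (corner₀-removed 0F) l′
  ... | refl | refl = refl
  copy-colour-proper {tri i σ q} {tri i′ σ′ q′} l l′ o o′ eq with tri-meet⇒same o o′ | inject₁-injective eq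
  ... | refl | refl
    with live-tri⇒opposite {corners₀} {i} {0F} {σ} (corner₀-removed (suc i)) l
       | live-tri⇒opposite {corners₀} {i} {0F} {σ′} (corner₀-removed (suc i)) l′
  ... | refl | refl = refl

  M≤Δ-corners₀ : M ≤ Δ graph corners₀
  M≤Δ-corners₀ = ≤-trans (≤deg {corners₀} {hubV 1F} ↔-refl (hub 0F) (λ { refl → refl }) live (λ _ ()))
                        (deg≤Δ graph corners₀ (index (hubV 1F)))
    where
    live : ∀ p → Live corners₀ (hub 0F p)
    live _ (hubV s) s≢0 r = s≢0 (corner₀-of-removed {hubV s} r)

  corners₀-class1 : Class1 graph corners₀
  corners₀-class1 = Colourable⇒Class1 graph {corners₀}
    (Colourable-mono graph {corners₀} M≤Δ-corners₀ (colourable {corners₀} copy-colour copy-colour-proper))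

  apex? : Vertex → Bool
  apex? y = ⌊ ≡-dec _≟_ _≟_ y (hubV 0F) ⌋

  apex : Subset (suc k * 3)
  apex = removal apex?

  apex-removed : ∀ {y} → Removed apex y → y ≡ hubV 0F
  apex-removed {y} r = toWitness (subst T (removed?-removal apex? y) r)

  removed-apex : Removed apex (hubV 0F)
  removed-apex = subst T (sym (removed?-removal apex? (hubV 0F))) tt

  ∣apex∣ : ∣ apex ∣ ≡ 1
  ∣apex∣ = ≤-antisym
    (∣∣≤ {apex} (↔-sym 1↔⊤) (λ _ _ → tt)
      λ {y} {y′} r r′ _ → trans (apex-removed {y} r) (sym (apex-removed {y′} r′)))
    (≤∣∣ {apex} {Y = ⊤} (↔-sym 1↔⊤) (λ _ → hubV 0F) (λ _ → refl) (λ _ → removed-apex))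

  layer-colour : Edge → Fin (3 * m)
  layer-colour (hub _ p)   = inject≤ p M≤3m
  layer-colour (tri _ σ q) = combine σ q
  layer-colour (pendant _) = 0F

  layer-colour-proper : Proper apex layer-colour
  layer-colour-proper {pendant _} l _ _ _ _ = ⊥-elim (pendant-dead {apex} removed-apex l)
  layer-colour-proper {_} {pendant _} _ l′ _ _ _ = ⊥-elim (pendant-dead {apex} removed-apex l′)
  layer-colour-proper {hub _ _}   {tri _ _ _} _ _ o o′ _ = ⊥-elim (hub-tri-apart o o′)
  layer-colour-proper {tri _ _ _} {hub _ _}   _ _ o o′ _ = ⊥-elim (hub-tri-apart o′ o)
  layer-colour-proper {hub σ p} {hub σ′ p′} l l′ _ _ eq
    with live-hub⇒opposite {apex} {0F} {σ} removed-apex l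
       | live-hub⇒opposite {apex} {0F} {σ′} removed-apex l′
       | inject≤-injective M≤3m M≤3m p p′ eq
  ... | refl | refl | refl = refl
  layer-colour-proper {tri i σ q} {tri i′ σ′ q′} _ _ o o′ eq
    with tri-meet⇒same o o′ | combine-injective σ q σ′ q′ eq
  ... | refl | refl , refl = refl

  χ′-apex : Fin k → IsChromaticIndex graph apex (3 * m)
  χ′-apex i = colourable {apex} layer-colour layer-colour-proper ,
              λ _ → triangle-clique {apex} i λ s r → triV≢hubV {i} {s} (apex-removed {triV i s} r)
    where
    triV≢hubV : ∀ {i s} → triV i s ≢ hubV 0F
    triV≢hubV ()

  connected-graph : Connected graph
  connected-graph = connected (hubV 0F) path
    where
    within-triangle : ∀ i s → Star Joined (triV i 0F) (triV i s)
    within-triangle i 0F = ε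
    within-triangle i 1F = (tri i 2F 0F , refl) ◅ ε
    within-triangle i 2F = (tri i 1F 0F , refl) ◅ ε
    path : ∀ y → Star Joined (hubV 0F) y
    path (hubV 0F)   = ε
    path (hubV 1F)   = (hub 2F 0F , refl) ◅ ε
    path (hubV 2F)   = (hub 1F 0F , refl) ◅ ε
    path (triV i s)  = (pendant i , refl) ◅ within-triangle i s

  rᵥ≡1+k : 1 ≤ k → IsRv graph (suc k)
  rᵥ≡1+k 1≤k = (corners₀ , ∣corners₀∣ , corners₀-class1) , λ S (col , _) →
    let h , hub-removed = hub-hit {S} (Δ≤2M+k S) col
        hit = triangle-hit {S} 1≤k hub-removed col
    in ≤∣∣-transversal {S} (λ { 0F → h ; (suc i) → proj₁ (hit i) })
                            (λ { 0F → hub-removed ; (suc i) → proj₂ (hit i) })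

  r′ᵥ≡1 : 1 ≤ k → IsRv' graph 1
  r′ᵥ≡1 1≤k = (apex , ∣apex∣ , 3 * m , χ′-apex (fromℕ< 1≤k) , 3m≤ΔG) , λ S χ′≤ΔG →
    let h , hub-removed = hub-hit {S} (Δ≤2M+k (replicate _ outside)) (AtMost⇒Colourable graph {S} χ′≤ΔG)
    in ≤∣∣ {S} {Y = ⊤} (↔-sym 1↔⊤) (λ _ → hubV h) (λ _ → refl) (λ _ → hub-removed)

proposition3p1 : (k : ℕ) → 1 ≤ k →
    ∃ λ (G : Graph) → Connected G × (∃ λ r → ∃ λ r' → IsRv G r × IsRv' G r' × r ≡ r' + k)
proposition3p1 k 1≤k = graph , connected-graph , suc k , 1 , rᵥ≡1+k 1≤k , r′ᵥ≡1 1≤k , refl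
  where open Gₖ k
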